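{- Under the action of $\mathrm{Aut}(D_{2p})$ on $A=A_1\cup A_2$, the cycle type of $\alpha_{s,t}\in \mathrm{Aut}(D_{2p})$ is $\mathrm{type}(\alpha_{s,t})=(b_1(\alpha_{s,t}),b_2(\alpha_{s,t}),\ldots,b_{\frac{3p-1}{2}}(\alpha_{s,t}))$, where \[ b_k(\alpha_{1,t})=\begin{cases} \frac{3p-1}{2} & \text{if } k=1 \text{ and } t=0,\\ \frac{p-1}{2} & \text{if } k=1 \text{ and } t\in\mathbb{Z}_p\setminus\{0\},\\ 1 & \text{if } k=p \text{ and } t\in\mathbb{Z}_p\setminus\{0\},\\ 0 & \text{otherwise}, \end{cases} \] and for each $1\neq s=z^{i_s}\in\mathbb{Z}_p^\times$ (i.e., $i_s\neq 0$) and $t\in\mathbb{Z}_p$, \[ b_k(\alpha_{s,t})=b_k(\alpha_{s,0})=\begin{cases} 1 & \text{if } k=1,\\ \frac{\gcd(2i_s,p-1)}{2} & \text{if } k=\frac{p-1}{\gcd(2i_s,p-1)},\\ \gcd(i_s,p-1) & \text{if } k=\frac{p-1}{\gcd(i_s,p-1)},\\ 0 & \text{otherwise}. \end{cases} \] (If $s=-1$, i.e., $i_s=\frac{p-1}{2}$, then $\frac{p-1}{\gcd(2i_s,p-1)}=1$, and so $b_1(\alpha_{ -1,t})=b_1(\alpha_{ -1,0})=1+\frac{\gcd(2i_s,p-1)}{2}=\frac{p+1}{2}$ for each $t\in\mathbb{Z}_p$.)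
   Context: Let $p$ be an odd prime and $D_{2p}=\langle\tau,\sigma\mid \tau^p=\sigma^2=e,\ \sigma\tau\sigma=\tau^{ -1}\rangle=\{\tau^i,\tau^j\sigma\mid i,j\in\mathbb{Z}_p\}$. Then $\mathrm{Aut}(D_{2p})=\{\alpha_{s,t}\mid s\in\mathbb{Z}_p^\times,\ t\in\mathbb{Z}_p\}$, where $\alpha_{s,t}(\tau^i)=\tau^{si}$ and $\alpha_{s,t}(\tau^j\sigma)=\tau^{sj+t}\sigma$. Let $A=A_1\cup A_2$ with $A_1=\{\bar{\tau}^i=\{\tau^i,\tau^{ -i}\}\mid 1\leq i\leq \frac{p-1}{2}\}$ and $A_2=\{\tau^j\sigma\mid j\in\mathbb{Z}_p\}$. $\mathrm{Aut}(D_{2p})$ acts (faithfully) on $A$ by $\alpha_{s,t}(\bar{\tau}^i)=\bar{\tau}^{si}$ and $\alpha_{s,t}(\tau^j\sigma)=\tau^{sj+t}\sigma$, so it is viewed as a permutation group on $A$. Let $z$ be a generator of the cyclic group $\mathbb{Z}_p^\times$, and for $s\in\mathbb{Z}_p^\times$ write $s=z^{i_s}$ with $i_s\in\mathbb{Z}_{p-1}$. For a permutation $g$, $b_k(g)$ denotes the number of cycles of length $k$ in the disjoint cycle decomposition of $g$. -}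

module Defs where

open import Data.Nat using (ℕ; zero; suc; _+_; _*_; _∸_; _^_; _/_; _%_; _≡ᵇ_; _≤ᵇ_)
open import Data.Bool using (Bool; true; false; if_then_else_; _∧_; not)
open import Data.List using (List; []; _∷_; map; _++_; upTo; filterᵇ; length)
open import Data.Bool.ListAction using (and)
open import Data.Product using (_×_; Σ)
open import Relation.Binary.PropositionalEquality using (_≡_)
import Data.Nat

-- Arithmetic in ℤ_p, with ℤ_p = {0,…,p-1} ⊆ ℕ.
-- 'mod' / 'div' are _%_ / _/_ guarded against a zero divisor (the
-- divisors used below are always nonzero under the hypotheses).

_mod_ : ℕ → ℕ → ℕ
x mod zero  = x
x mod suc n = x % suc n

_div_ : ℕ → ℕ → ℕ
x div zero  = zero
x div suc n = x / suc n

-- The set A = A₁ ∪ A₂.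
--   bar i  stands for  τ̄^i = {τ^i, τ^{-i}}   (1 ≤ i ≤ (p-1)/2)
--   ref j  stands for  τ^j σ                  (j ∈ ℤ_p)

data Pt : Set where
  bar : ℕ → Pt
  ref : ℕ → Pt

points : ℕ → List Pt
points p = map (λ i → bar (suc i)) (upTo ((p ∸ 1) / 2)) ++ map ref (upTo p)

barIndex : ℕ → ℕ → ℕ
barIndex p r = if r ≤ᵇ ((p ∸ 1) / 2) then r else p ∸ r

α : (p s t : ℕ) → Pt → Pt
α p s t (bar i) = bar (barIndex p ((s * i) mod p))
α p s t (ref j) = ref ((s * j + t) mod p)

_==_ : Pt → Pt → Bool
bar i == bar j = i ≡ᵇ j
ref i == ref j = i ≡ᵇ j
_     == _     = false

-- a total order on A (used only to pick one representative per cycle)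
_≼_ : Pt → Pt → Bool
bar i ≼ bar j = i ≤ᵇ j
bar _ ≼ ref _ = true
ref _ ≼ bar _ = false
ref i ≼ ref j = i ≤ᵇ j

iter : (Pt → Pt) → ℕ → Pt → Pt
iter f zero    x = x
iter f (suc n) x = f (iter f n x)

-- x lies on a cycle of f of length exactly k (k ≥ 1) and is the
-- ≼-least element of that cycle
isCycleRep : (Pt → Pt) → ℕ → Pt → Bool
isCycleRep f zero    x = false
isCycleRep f (suc m) x =
  (iter f (suc m) x == x) ∧
  and (map (λ j → not (iter f (suc j) x == x) ∧ (x ≼ iter f (suc j) x)) (upTo m))

cycles : (Pt → Pt) → List Pt → ℕ → ℕ
cycles f xs k = length (filterᵇ (isCycleRep f k) xs)

b : (p s t k : ℕ) → ℕ
b p s t k = cycles (α p s t) (points p) k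

IsGenerator : ℕ → ℕ → Set
IsGenerator p z = 1 Data.Nat.≤ z × z Data.Nat.< p
  × (∀ s → 1 Data.Nat.≤ s → s Data.Nat.< p → Σ ℕ λ i → (z ^ i) mod p ≡ s)

[_≡_]*_ : ℕ → ℕ → ℕ → ℕ
[ k ≡ m ]* v = if k ≡ᵇ m then v else 0

module Submission where

-- Cycles are counted by double counting: if f permutes a duplicate-free list on which
-- every point has exact period d, each orbit contains exactly one cycle representative
-- (its ≼-least point), so the list consists of (length / d) cycles of length d.
-- Write p = 2m + 1 and s = z^i. For s ≠ 1 the map τʲσ ↦ τ^{sj+t}σ has a unique fixed
-- point j₀ and sends j₀ + e to j₀ + s e, so the other 2m points of A₂ return after n
-- steps iff sⁿ ≡ 1, i.e. 2m ∣ i n, i.e. 2m / gcd(i, 2m) ∣ n. A point τ̄ʳ of A₁ returns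
-- iff sⁿ ≡ ±1, i.e. s²ⁿ ≡ 1, i.e. 2m / gcd(2i, 2m) ∣ n. For s = 1 the map is the
-- identity on A₁, and on A₂ the identity (t = 0) or a single p-cycle (t ≠ 0).

open import Defs
open import Data.Nat using (ℕ; _+_; _*_; _∸_; _/_; _≤_; _<_)
open import Data.Nat.GCD using (gcd)
open import Data.Nat.Divisibility using (_∣_)
open import Data.Nat.Primality using (Prime)
open import Data.Product using (_×_)
open import Relation.Nullary using (¬_)
open import Relation.Binary.PropositionalEquality using (_≡_; _≢_)

open import Data.Bool using (Bool; true; false; T; T?; not; _∧_; if_then_else_)
open import Data.Bool.Properties using (T-∧)
open import Data.Empty using (⊥-elim)
open import Data.Fin using (Fin; toℕ; fromℕ<)
open import Data.Fin.Properties using (pigeonhole; toℕ<n; toℕ-fromℕ<)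
open import Data.List using (List; []; _∷_; map; _++_; length; filter; filterᵇ; upTo; downFrom)
open import Data.List.Properties
  using (map-∘; map-id; map-id-local; filter-none; length-map; length-upTo; length-downFrom; filter-++; length-++)
open import Data.List.Membership.Propositional using (_∈_)
open import Data.List.Membership.Propositional.Properties
  using (∈-map⁺; ∈-map⁻; ∈-upTo⁺; ∈-upTo⁻; ∈-downFrom⁻; ∈-filter⁺; ∈-filter⁻)
open import Data.List.Membership.Propositional.Properties.WithK using (unique∧set⇒bag)
open import Data.List.Relation.Unary.Any using (here; there)
import Data.List.Relation.Unary.All as All
open import Data.List.Relation.Unary.All.Properties using (all⁺; all⁻)
import Data.List.Relation.Unary.AllPairs as AllPairs
open import Data.List.Relation.Unary.Unique.Propositional using (Unique)
import Data.List.Relation.Unary.Unique.Propositional.Properties as Unique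
open import Data.List.Relation.Binary.Permutation.Propositional using (_↭_; ↭-trans; ↭-reflexive)
open import Data.List.Relation.Binary.Permutation.Propositional.Properties using (map⁺; ↭-length; filter-↭)
open import Data.List.Relation.Binary.BagAndSetEquality using (∼bag⇒↭)
open import Data.Nat
open import Data.Nat.Properties
open import Algebra.Properties.CommutativeSemigroup +-commutativeSemigroup using (interchange)
open import Data.Nat.DivMod hiding (_mod_; _div_)
open import Data.Nat.Divisibility
open import Data.Nat.Coprimality using (coprime-/gcd; coprime-divisor)
import Data.Nat.Coprimality as Coprime
open import Data.Nat.GCD using (gcd[m,n]∣m; gcd[m,n]∣n; gcd[m,n]≢0; gcd-greatest)
open import Data.Nat.ListAction using (sum)
open import Data.Nat.ListAction.Properties using (sum-↭)
open import Data.Nat.Primality using (euclidsLemma; prime⇒nonZero; ¬prime[1])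
open import Data.Nat.Tactic.RingSolver using (solve-∀)
open import Data.Product using (∃; _,_; proj₁; proj₂; uncurry)
open import Data.Sum using (_⊎_; inj₁; inj₂)
import Data.Sum as Sum
open import Function using (_∘_; case_of_; _⇔_; mk⇔; Equivalence)
import Function.Properties.Equivalence as ⇔
open import Relation.Binary.Bundles using (Setoid)
open import Relation.Binary.Definitions using (tri<; tri≈; tri>)
open import Relation.Binary.PropositionalEquality hiding ([_])
import Relation.Binary.Reasoning.Setoid
open import Relation.Nullary using (yes; no; ¬?)

open Equivalence using (to; from)

private
  variable
    A : Set

fromBool : Bool → ℕ
fromBool b = if b then 1 else 0

fromBool-T : ∀ {b} → T b → fromBool b ≡ 1
fromBool-T {true} _ = refl

fromBool-¬T : ∀ {b} → ¬ T b → fromBool b ≡ 0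
fromBool-¬T {true} ¬b = ⊥-elim (¬b _)
fromBool-¬T {false} _ = refl

T-not : ∀ {b} → ¬ T b → T (not b)
T-not {true} ¬b = ¬b _
T-not {false} _ = _

T-not⁻ : ∀ {b} → T (not b) → ¬ T b
T-not⁻ {true} () _

[≡]*-refl : ∀ k c → [ k ≡ k ]* c ≡ c
[≡]*-refl zero    c = refl
[≡]*-refl (suc k) c = [≡]*-refl k c

[≡]*-≢ : ∀ {k d} → k ≢ d → ∀ c → [ k ≡ d ]* c ≡ 0
[≡]*-≢ {k} {d} k≢d c with k ≡ᵇ d in k≡ᵇd
... | true  = ⊥-elim (k≢d (≡ᵇ⇒≡ k d (subst T (sym k≡ᵇd) _)))
... | false = refl

[≡]*-+ : ∀ k d a b → [ k ≡ d ]* a + [ k ≡ d ]* b ≡ [ k ≡ d ]* (a + b)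
[≡]*-+ k d a b with k ≡ᵇ d
... | true  = refl
... | false = refl


sum-map-+ : (g h : A → ℕ) (xs : List A) →
            sum (map (λ x → g x + h x) xs) ≡ sum (map g xs) + sum (map h xs)
sum-map-+ g h [] = refl
sum-map-+ g h (x ∷ xs) = trans (cong (g x + h x +_) (sum-map-+ g h xs))
                               (interchange (g x) (h x) (sum (map g xs)) (sum (map h xs)))

sum-map-const : (c : ℕ) (xs : List A) → sum (map (λ _ → c) xs) ≡ length xs * c
sum-map-const c [] = refl
sum-map-const c (x ∷ xs) = cong (c +_) (sum-map-const c xs)

sum-map-cong : {g h : A → ℕ} (xs : List A) → (∀ {x} → x ∈ xs → g x ≡ h x) →
               sum (map g xs) ≡ sum (map h xs)
sum-map-cong [] eq = refl
sum-map-cong (x ∷ xs) eq = cong₂ _+_ (eq (here refl)) (sum-map-cong xs (eq ∘ there))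

sum-map-swap : {B : Set} (F : A → B → ℕ) (xs : List A) (ys : List B) →
  sum (map (λ x → sum (map (F x) ys)) xs) ≡ sum (map (λ y → sum (map (λ x → F x y) xs)) ys)
sum-map-swap F [] ys = sym (trans (sum-map-const 0 ys) (*-zeroʳ (length ys)))
sum-map-swap F (x ∷ xs) ys = trans (cong (sum (map (F x) ys) +_) (sum-map-swap F xs ys))
                                   (sym (sum-map-+ (F x) _ ys))

sum-map-↭ : (g : A → ℕ) {xs ys : List A} → xs ↭ ys → sum (map g xs) ≡ sum (map g ys)
sum-map-↭ g = sum-↭ ∘ map⁺ g

↭-∷-filter≢ : ∀ {xs : List ℕ} {x} → Unique xs → x ∈ xs → xs ↭ x ∷ filter (¬? ∘ (_≟ x)) xs
↭-∷-filter≢ {xs} {x} unique x∈ = ∼bag⇒↭ (unique∧set⇒bag unique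
  (All.tabulate (λ y∈ → proj₂ (∈-filter⁻ (¬? ∘ (_≟ x)) {xs = xs} y∈) ∘ sym) AllPairs.∷ Unique.filter⁺ (¬? ∘ (_≟ x)) {xs} unique)
  (mk⇔ ⊆ ⊇))
  where
  ⊆ : ∀ {y} → y ∈ xs → y ∈ x ∷ filter (¬? ∘ (_≟ x)) xs
  ⊆ {y} y∈ with y ≟ x
  ... | yes refl = here refl
  ... | no y≢x = there (∈-filter⁺ (¬? ∘ (_≟ x)) y∈ y≢x)
  ⊇ : ∀ {y} → y ∈ x ∷ filter (¬? ∘ (_≟ x)) xs → y ∈ xs
  ⊇ (here refl) = x∈
  ⊇ (there y∈) = proj₁ (∈-filter⁻ (¬? ∘ (_≟ x)) y∈)

sum-downFrom-single : (F : ℕ → ℕ) {m n₀ : ℕ} → n₀ < m → F n₀ ≡ 1 →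
  (∀ n → n < m → n ≢ n₀ → F n ≡ 0) → sum (map F (downFrom m)) ≡ 1
sum-downFrom-single F {suc m} {n₀} n₀<1+m Fn₀≡1 others with m ≟ n₀
... | yes refl = cong₂ _+_ Fn₀≡1 (trans (sum-map-cong (downFrom m) rest≡0) (sum-zero (downFrom m)))
  where
  rest≡0 : ∀ {n} → n ∈ downFrom m → F n ≡ 0
  rest≡0 n∈ = others _ (m<n⇒m<1+n (∈-downFrom⁻ n∈)) (<⇒≢ (∈-downFrom⁻ n∈))
  sum-zero : (ns : List ℕ) → sum (map (λ _ → 0) ns) ≡ 0
  sum-zero ns = trans (sum-map-const 0 ns) (*-zeroʳ (length ns))
... | no m≢n₀ = cong₂ _+_ (others m ≤-refl m≢n₀)
  (sum-downFrom-single F (≤∧≢⇒< (≤-pred n₀<1+m) (m≢n₀ ∘ sym)) Fn₀≡1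
    (λ n n<m → others n (m<n⇒m<1+n n<m)))

length-filterᵇ≡sum : (P : A → Bool) (xs : List A) → length (filterᵇ P xs) ≡ sum (map (fromBool ∘ P) xs)
length-filterᵇ≡sum P [] = refl
length-filterᵇ≡sum P (x ∷ xs) with P x
... | true = cong suc (length-filterᵇ≡sum P xs)
... | false = length-filterᵇ≡sum P xs

bar-injective : ∀ {i j} → bar i ≡ bar j → i ≡ j
bar-injective refl = refl

ref-injective : ∀ {i j} → ref i ≡ ref j → i ≡ j
ref-injective refl = refl

==⇒≡ : ∀ x y → T (x == y) → x ≡ y
==⇒≡ (bar i) (bar j) eq = cong bar (≡ᵇ⇒≡ i j eq)
==⇒≡ (ref i) (ref j) eq = cong ref (≡ᵇ⇒≡ i j eq)

==-refl : ∀ x → T (x == x)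
==-refl (bar i) = ≡⇒≡ᵇ i i refl
==-refl (ref i) = ≡⇒≡ᵇ i i refl

≼-refl : ∀ x → T (x ≼ x)
≼-refl (bar i) = ≤⇒≤ᵇ (≤-refl {i})
≼-refl (ref i) = ≤⇒≤ᵇ (≤-refl {i})

≼-trans : ∀ x y z → T (x ≼ y) → T (y ≼ z) → T (x ≼ z)
≼-trans (bar i) (bar j) (bar k) i≤j j≤k = ≤⇒≤ᵇ (≤-trans (≤ᵇ⇒≤ i j i≤j) (≤ᵇ⇒≤ j k j≤k))
≼-trans (bar i) (bar j) (ref k) _ _ = _
≼-trans (bar i) (ref j) (ref k) _ _ = _
≼-trans (ref i) (ref j) (ref k) i≤j j≤k = ≤⇒≤ᵇ (≤-trans (≤ᵇ⇒≤ i j i≤j) (≤ᵇ⇒≤ j k j≤k))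

≼-antisym : ∀ x y → T (x ≼ y) → T (y ≼ x) → x ≡ y
≼-antisym (bar i) (bar j) i≤j j≤i = cong bar (≤-antisym (≤ᵇ⇒≤ i j i≤j) (≤ᵇ⇒≤ j i j≤i))
≼-antisym (ref i) (ref j) i≤j j≤i = cong ref (≤-antisym (≤ᵇ⇒≤ i j i≤j) (≤ᵇ⇒≤ j i j≤i))

≼-total : ∀ x y → T (x ≼ y) ⊎ T (y ≼ x)
≼-total (bar i) (bar j) = Sum.map ≤⇒≤ᵇ ≤⇒≤ᵇ (≤-total i j)
≼-total (bar i) (ref j) = inj₁ _
≼-total (ref i) (bar j) = inj₂ _
≼-total (ref i) (ref j) = Sum.map ≤⇒≤ᵇ ≤⇒≤ᵇ (≤-total i j)

≼-argmin : (g : ℕ → Pt) (m : ℕ) → ∃ λ n₀ → n₀ < suc m × (∀ j → j < suc m → T (g n₀ ≼ g j))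
≼-argmin g zero = 0 , z<s , λ { zero _ → ≼-refl (g 0) ; (suc j) (s≤s ()) }
≼-argmin g (suc m) with ≼-argmin g m
... | n₀ , n₀≤m , least with ≼-total (g n₀) (g (suc m))
...   | inj₁ n₀≼ = n₀ , m<n⇒m<1+n n₀≤m , λ j j≤1+m → case m<1+n⇒m<n∨m≡n j≤1+m of λ where
          (inj₁ j≤m)  → least j j≤m
          (inj₂ refl) → n₀≼
...   | inj₂ ≼n₀ = suc m , ≤-refl , λ j j≤1+m → case m<1+n⇒m<n∨m≡n j≤1+m of λ where
          (inj₁ j≤m)  → ≼-trans (g (suc m)) (g n₀) (g j) ≼n₀ (least j j≤m)
          (inj₂ refl) → ≼-refl (g (suc m))

iter-+ : ∀ f m n x → iter f (m + n) x ≡ iter f m (iter f n x)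
iter-+ f zero n x = refl
iter-+ f (suc m) n x = cong f (iter-+ f m n x)

iter-fixed : ∀ f {x} → f x ≡ x → ∀ n → iter f n x ≡ x
iter-fixed f fx≡x zero = refl
iter-fixed f fx≡x (suc n) = trans (cong f (iter-fixed f fx≡x n)) fx≡x

Period : (Pt → Pt) → ℕ → Pt → Set
Period f d x = ∀ n → iter f n x ≡ x ⇔ d ∣ n

module UniformPeriod (f : Pt → Pt) (d₀ : ℕ) (xs : List Pt) (unique : Unique xs)
  (closed : ∀ {x} → x ∈ xs → f x ∈ xs) (period : ∀ {x} → x ∈ xs → Period f (suc d₀) x) where

  d : ℕ
  d = suc d₀

  iter-closed : ∀ n {x} → x ∈ xs → iter f n x ∈ xs
  iter-closed zero x∈ = x∈
  iter-closed (suc n) x∈ = closed (iter-closed n x∈)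

  iter-d : ∀ {x} → x ∈ xs → iter f d x ≡ x
  iter-d x∈ = from (period x∈ d) ∣-refl

  iter-%-d : ∀ n {x} → x ∈ xs → iter f n x ≡ iter f (n % d) x
  iter-%-d n {x} x∈ = begin
    iter f n x                             ≡⟨ cong (λ k → iter f k x) (m≡m%n+[m/n]*n n d) ⟩
    iter f (n % d + n / d * d) x           ≡⟨ iter-+ f (n % d) (n / d * d) x ⟩
    iter f (n % d) (iter f (n / d * d) x)  ≡⟨ cong (iter f (n % d)) (from (period x∈ _) (n∣m*n (n / d))) ⟩
    iter f (n % d) x                       ∎
    where open ≡-Reasoning

  iter-distinct : ∀ {x} → x ∈ xs → ∀ {n k} → n < k → k < d → iter f n x ≢ iter f k x
  iter-distinct {x} x∈ {n} {k} n<k k<d eq =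
    >⇒∤ {{>-nonZero (m<n⇒0<n∸m n<k)}} (≤-<-trans (m∸n≤m k n) k<d) (to (period (iter-closed n x∈) (k ∸ n)) returns)
    where
    returns : iter f (k ∸ n) (iter f n x) ≡ iter f n x
    returns = trans (sym (iter-+ f (k ∸ n) n x)) (trans (cong (λ j → iter f j x) (m∸n+n≡m (<⇒≤ n<k))) (sym eq))

  iter-injective : ∀ {x} → x ∈ xs → ∀ {n k} → n < d → k < d → iter f n x ≡ iter f k x → n ≡ k
  iter-injective x∈ {n} {k} n<d k<d eq with <-cmp n k
  ... | tri< n<k _ _ = ⊥-elim (iter-distinct x∈ n<k k<d eq)
  ... | tri≈ _ n≡k _ = n≡k
  ... | tri> _ _ k<n = ⊥-elim (iter-distinct x∈ k<n n<d (sym eq))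

  private
    step : Pt → ℕ → Bool
    step x j = not (iter f (suc j) x == x) ∧ (x ≼ iter f (suc j) x)

  returns-after-d : ∀ {x} → x ∈ xs → T (iter f d x == x)
  returns-after-d {x} x∈ = subst (λ y → T (y == x)) (sym (iter-d x∈)) (==-refl x)

  rep⇒least : ∀ {x} → x ∈ xs → T (isCycleRep f d x) → ∀ j → T (x ≼ iter f j x)
  rep⇒least {x} x∈ rep j rewrite iter-%-d j x∈ with j % d | m%n<n j d
  ... | zero   | _          = ≼-refl x
  ... | suc j′ | s≤s j′<d₀ =
    proj₂ (to T-∧ (All.lookup (all⁺ (step x) (upTo d₀) (proj₂ (to T-∧ rep))) (∈-upTo⁺ j′<d₀)))

  least⇒rep : ∀ {x} → x ∈ xs → (∀ j → T (x ≼ iter f j x)) → T (isCycleRep f d x)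
  least⇒rep {x} x∈ least = from T-∧ (returns-after-d x∈ , all⁻ (step x) (All.tabulate λ {j} j∈ →
      from T-∧ (T-not (noEarlyReturn (∈-upTo⁻ j∈)) , least (suc j))))
    where
    noEarlyReturn : ∀ {j} → j < d₀ → ¬ T (iter f (suc j) x == x)
    noEarlyReturn j<d₀ eq = >⇒∤ (s≤s j<d₀) (to (period x∈ _) (==⇒≡ _ _ eq))

  ¬rep : ∀ {x} → x ∈ xs → ∀ {k} → k ≢ d → ¬ T (isCycleRep f k x)
  ¬rep x∈ {zero} _ ()
  ¬rep {x} x∈ {suc k} k≢d rep
    with returns , steps ← to T-∧ rep
    with m≤n⇒m<n∨m≡n (∣⇒≤ (to (period x∈ (suc k)) (==⇒≡ _ _ returns)))
  ... | inj₂ d≡k = k≢d (sym d≡k)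
  ... | inj₁ (s≤s d₀<k) =
    T-not⁻ (proj₁ (to T-∧ (All.lookup (all⁺ (step x) (upTo k) steps) (∈-upTo⁺ d₀<k)))) (returns-after-d x∈)

  rep : Pt → ℕ
  rep y = fromBool (isCycleRep f d y)

  -- the ≼-least point of an orbit is its only representative
  orbit-rep-count : ∀ {x} → x ∈ xs → sum (map (λ n → rep (iter f n x)) (downFrom d)) ≡ 1
  orbit-rep-count {x} x∈ with n₀ , n₀<d , least ← ≼-argmin (λ n → iter f n x) d₀ =
    sum-downFrom-single (λ n → rep (iter f n x)) n₀<d (fromBool-T n₀-rep) others
    where
    n₀-rep : T (isCycleRep f d (iter f n₀ x))
    n₀-rep = least⇒rep (iter-closed n₀ x∈) λ j →
      subst (λ y → T (iter f n₀ x ≼ y))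
            (trans (sym (iter-%-d (j + n₀) x∈)) (iter-+ f j n₀ x))
            (least ((j + n₀) % d) (m%n<n (j + n₀) d))
    back-to-n₀ : ∀ {n} → n < d → iter f (n₀ + (d ∸ n)) (iter f n x) ≡ iter f n₀ x
    back-to-n₀ {n} n<d = begin
      iter f (n₀ + (d ∸ n)) (iter f n x)  ≡⟨ iter-+ f (n₀ + (d ∸ n)) n x ⟨
      iter f (n₀ + (d ∸ n) + n) x         ≡⟨ cong (λ k → iter f k x) (trans (+-assoc n₀ (d ∸ n) n) (cong (n₀ +_) (m∸n+n≡m (<⇒≤ n<d)))) ⟩
      iter f (n₀ + d) x                   ≡⟨ iter-+ f n₀ d x ⟩
      iter f n₀ (iter f d x)              ≡⟨ cong (iter f n₀) (iter-d x∈) ⟩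
      iter f n₀ x                         ∎
      where open ≡-Reasoning
    others : ∀ n → n < d → n ≢ n₀ → rep (iter f n x) ≡ 0
    others n n<d n≢n₀ = fromBool-¬T λ n-rep → n≢n₀ (iter-injective x∈ n<d n₀<d
      (≼-antisym _ _ (subst (λ y → T (iter f n x ≼ y)) (back-to-n₀ n<d)
                            (rep⇒least (iter-closed n x∈) n-rep (n₀ + (d ∸ n))))
                     (least n n<d)))

  map-f-↭ : map f xs ↭ xs
  map-f-↭ = ∼bag⇒↭ (unique∧set⇒bag unique-map unique (mk⇔ ⊆xs ⊇xs))
    where
    f-inverse : ∀ {x} → x ∈ xs → iter f d₀ (f x) ≡ x
    f-inverse {x} x∈ = trans (sym (iter-+ f d₀ 1 x)) (trans (cong (λ k → iter f k x) (+-comm d₀ 1)) (iter-d x∈))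
    unique-map : Unique (map f xs)
    unique-map = Unique.map⁻ {f = iter f d₀} (subst Unique (sym (trans (sym (map-∘ xs)) (map-id-local (All.tabulate f-inverse)))) unique)
    ⊆xs : ∀ {y} → y ∈ map f xs → y ∈ xs
    ⊆xs y∈ with x , x∈ , refl ← ∈-map⁻ f y∈ = closed x∈
    ⊇xs : ∀ {y} → y ∈ xs → y ∈ map f xs
    ⊇xs y∈ = subst (_∈ map f xs) (iter-d y∈) (∈-map⁺ f (iter-closed d₀ y∈))

  map-iter-↭ : ∀ n → map (iter f n) xs ↭ xs
  map-iter-↭ zero = ↭-reflexive (map-id xs)
  map-iter-↭ (suc n) = ↭-trans (↭-reflexive (map-∘ xs)) (↭-trans (map⁺ f (map-iter-↭ n)) map-f-↭)

  sum-map-iter : ∀ n (g : Pt → ℕ) → sum (map (g ∘ iter f n) xs) ≡ sum (map g xs)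
  sum-map-iter n g = trans (cong sum (map-∘ xs)) (sum-map-↭ g (map-iter-↭ n))

  reps*d≡length : length (filterᵇ (isCycleRep f d) xs) * d ≡ length xs
  reps*d≡length = begin
    length (filterᵇ (isCycleRep f d) xs) * d                    ≡⟨ cong (_* d) (length-filterᵇ≡sum _ xs) ⟩
    sum (map rep xs) * d                                        ≡⟨ *-comm (sum (map rep xs)) d ⟩
    d * sum (map rep xs)                                        ≡⟨ cong (_* sum (map rep xs)) (length-downFrom d) ⟨
    length (downFrom d) * sum (map rep xs)                      ≡⟨ sum-map-const _ (downFrom d) ⟨
    sum (map (λ _ → sum (map rep xs)) (downFrom d))             ≡⟨ sum-map-cong (downFrom d) (λ {n} _ → sum-map-iter n rep) ⟨
    sum (map (λ n → sum (map (rep ∘ iter f n) xs)) (downFrom d)) ≡⟨ sum-map-swap (λ x n → rep (iter f n x)) xs (downFrom d) ⟨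
    sum (map (λ x → sum (map (λ n → rep (iter f n x)) (downFrom d))) xs) ≡⟨ sum-map-cong xs orbit-rep-count ⟩
    sum (map (λ _ → 1) xs)                                      ≡⟨ sum-map-const 1 xs ⟩
    length xs * 1                                               ≡⟨ *-identityʳ (length xs) ⟩
    length xs                                                   ∎
    where open ≡-Reasoning

cycles-uniform : ∀ f d .{{_ : NonZero d}} (xs : List Pt) → Unique xs →
  (∀ {x} → x ∈ xs → f x ∈ xs) → (∀ {x} → x ∈ xs → Period f d x) →
  ∀ {c} → c * d ≡ length xs → ∀ k → cycles f xs k ≡ [ k ≡ d ]* c
cycles-uniform f (suc d₀) xs unique closed period {c} c*d≡length k with k ≟ suc d₀
... | yes refl = trans (*-cancelʳ-≡ _ c (suc d₀) (trans reps*d≡length (sym c*d≡length))) (sym ([≡]*-refl k c))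
  where open UniformPeriod f d₀ xs unique closed period
... | no k≢d = trans (cong length (filter-none (T? ∘ isCycleRep f k) (All.tabulate (λ x∈ → ¬rep x∈ k≢d)))) (sym ([≡]*-≢ k≢d c))
  where open UniformPeriod f d₀ xs unique closed period

fixed⇒period-1 : ∀ f {x} → f x ≡ x → Period f 1 x
fixed⇒period-1 f fx≡x n = mk⇔ (λ _ → 1∣ n) (λ _ → iter-fixed f fx≡x n)

cycles-fixed : ∀ f {x} → f x ≡ x → ∀ k → cycles f (x ∷ []) k ≡ [ k ≡ 1 ]* 1
cycles-fixed f {x} fx≡x = cycles-uniform f 1 (x ∷ []) (All.[] AllPairs.∷ AllPairs.[]) (λ { (here refl) → here fx≡x })
  (λ { (here refl) → fixed⇒period-1 f fx≡x }) refl

cycles-++ : ∀ f xs ys k → cycles f (xs ++ ys) k ≡ cycles f xs k + cycles f ys k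
cycles-++ f xs ys k = trans (cong length (filter-++ _ xs ys)) (length-++ (filterᵇ (isCycleRep f k) xs))

cycles-↭ : ∀ f {xs ys} → xs ↭ ys → ∀ k → cycles f xs k ≡ cycles f ys k
cycles-↭ f xs↭ys k = ↭-length (filter-↭ _ xs↭ys)


module Congruence (p : ℕ) .{{_ : NonZero p}} where

  infix 4 _≈_ _≈±_

  record _≈_ (a b : ℕ) : Set where
    constructor mk≈
    field %-≡ : a % p ≡ b % p

  open _≈_ public

  ≈-refl : ∀ {a} → a ≈ a
  ≈-refl = mk≈ refl

  ≈-sym : ∀ {a b} → a ≈ b → b ≈ a
  ≈-sym (mk≈ eq) = mk≈ (sym eq)

  ≈-trans : ∀ {a b c} → a ≈ b → b ≈ c → a ≈ c
  ≈-trans (mk≈ eq) (mk≈ eq′) = mk≈ (trans eq eq′)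

  ≡⇒≈ : ∀ {a b} → a ≡ b → a ≈ b
  ≡⇒≈ refl = ≈-refl

  ≈-setoid : Setoid _ _
  ≈-setoid = record { _≈_ = _≈_ ; isEquivalence = record { refl = ≈-refl ; sym = ≈-sym ; trans = ≈-trans } }

  module ≈-Reasoning = Relation.Binary.Reasoning.Setoid ≈-setoid

  %-≈ : ∀ a → a % p ≈ a
  %-≈ a = mk≈ (m%n%n≡m%n a p)

  +-cong : ∀ {a a′ b b′} → a ≈ a′ → b ≈ b′ → a + b ≈ a′ + b′
  +-cong {a} {a′} {b} {b′} (mk≈ eq) (mk≈ eq′) = mk≈ (begin
    (a + b) % p               ≡⟨ %-distribˡ-+ a b p ⟩
    (a % p + b % p) % p       ≡⟨ cong₂ (λ x y → (x + y) % p) eq eq′ ⟩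
    (a′ % p + b′ % p) % p     ≡⟨ %-distribˡ-+ a′ b′ p ⟨
    (a′ + b′) % p             ∎)
    where open ≡-Reasoning

  *-cong : ∀ {a a′ b b′} → a ≈ a′ → b ≈ b′ → a * b ≈ a′ * b′
  *-cong {a} {a′} {b} {b′} (mk≈ eq) (mk≈ eq′) = mk≈ (begin
    (a * b) % p               ≡⟨ %-distribˡ-* a b p ⟩
    (a % p * (b % p)) % p     ≡⟨ cong₂ (λ x y → (x * y) % p) eq eq′ ⟩
    (a′ % p * (b′ % p)) % p   ≡⟨ %-distribˡ-* a′ b′ p ⟨
    (a′ * b′) % p             ∎)
    where open ≡-Reasoning

  ^-congˡ : ∀ {a b} n → a ≈ b → a ^ n ≈ b ^ n
  ^-congˡ zero    _  = ≈-refl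
  ^-congˡ (suc n) eq = *-cong eq (^-congˡ n eq)

  ≈0⇒∣ : ∀ {a} → a ≈ 0 → p ∣ a
  ≈0⇒∣ {a} (mk≈ eq) = m%n≡0⇒n∣m a p (trans eq (n∣m⇒m%n≡0 0 p (p ∣0)))

  ∣⇒≈0 : ∀ {a} → p ∣ a → a ≈ 0
  ∣⇒≈0 {a} p∣a = mk≈ (trans (n∣m⇒m%n≡0 a p p∣a) (sym (n∣m⇒m%n≡0 0 p (p ∣0))))

  ≈⇒≡ : ∀ {a b} → a < p → b < p → a ≈ b → a ≡ b
  ≈⇒≡ a<p b<p (mk≈ eq) = trans (sym (m<n⇒m%n≡m a<p)) (trans eq (m<n⇒m%n≡m b<p))

  ≈⇒∣∣-∣ : ∀ {a b} → a ≈ b → p ∣ ∣ a - b ∣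
  ≈⇒∣∣-∣ {a} {b} (mk≈ eq) = subst (p ∣_) (sym distance) (n∣m*n ∣ a / p - b / p ∣)
    where
    open ≡-Reasoning
    distance : ∣ a - b ∣ ≡ ∣ a / p - b / p ∣ * p
    distance = begin
      ∣ a - b ∣                                       ≡⟨ cong₂ ∣_-_∣ (m≡m%n+[m/n]*n a p) (m≡m%n+[m/n]*n b p) ⟩
      ∣ a % p + a / p * p - b % p + b / p * p ∣       ≡⟨ cong (λ r → ∣ a % p + a / p * p - r + b / p * p ∣) eq ⟨
      ∣ a % p + a / p * p - a % p + b / p * p ∣       ≡⟨ ∣m+n-m+o∣≡∣n-o∣ (a % p) _ _ ⟩
      ∣ a / p * p - b / p * p ∣                       ≡⟨ *-distribʳ-∣-∣ p (a / p) (b / p) ⟨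
      ∣ a / p - b / p ∣ * p                           ∎

  ∣∸∣⇒≈ : ∀ {a b} → a ≤ b → p ∣ b ∸ a → b ≈ a
  ∣∸∣⇒≈ {a} {b} a≤b p∣b∸a = mk≈ (trans (cong (_% p) (sym (m+[n∸m]≡n a≤b))) (%-remove-+ʳ a p∣b∸a))

  ∣∣-∣⇒≈ : ∀ {a b} → p ∣ ∣ a - b ∣ → a ≈ b
  ∣∣-∣⇒≈ {a} {b} p∣ with ≤-total a b
  ... | inj₁ a≤b = ≈-sym (∣∸∣⇒≈ a≤b (subst (p ∣_) (m≤n⇒∣m-n∣≡n∸m a≤b) p∣))
  ... | inj₂ b≤a = ∣∸∣⇒≈ b≤a (subst (p ∣_) (m≤n⇒∣n-m∣≡n∸m b≤a) p∣)

  +-cancelˡ : ∀ c {a b} → c + a ≈ c + b → a ≈ b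
  +-cancelˡ c {a} {b} eq = ∣∣-∣⇒≈ (subst (p ∣_) (∣m+n-m+o∣≡∣n-o∣ c a b) (≈⇒∣∣-∣ eq))

  +-cancelʳ : ∀ c {a b} → a + c ≈ b + c → a ≈ b
  +-cancelʳ c {a} {b} eq = +-cancelˡ c (subst₂ _≈_ (+-comm a c) (+-comm b c) eq)

  ≈-respˡ-⇔ : ∀ {a b c} → a ≈ b → a ≈ c ⇔ b ≈ c
  ≈-respˡ-⇔ a≈b = mk⇔ (≈-trans (≈-sym a≈b)) (≈-trans a≈b)

  data _≈±_ (a b : ℕ) : Set where
    plus  : a ≈ b → a ≈± b
    minus : a + b ≈ 0 → a ≈± b

  ≡⇒≈± : ∀ {a b} → a ≡ b → a ≈± b
  ≡⇒≈± = plus ∘ ≡⇒≈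

  ≈±-refl : ∀ {a} → a ≈± a
  ≈±-refl = plus ≈-refl

  ≈±-sym : ∀ {a b} → a ≈± b → b ≈± a
  ≈±-sym (plus eq) = plus (≈-sym eq)
  ≈±-sym {a} {b} (minus eq) = minus (≈-trans (≡⇒≈ (+-comm b a)) eq)

  ≈±-trans : ∀ {a b c} → a ≈± b → b ≈± c → a ≈± c
  ≈±-trans (plus eq) (plus eq′) = plus (≈-trans eq eq′)
  ≈±-trans (plus eq) (minus eq′) = minus (≈-trans (+-cong eq ≈-refl) eq′)
  ≈±-trans (minus eq) (plus eq′) = minus (≈-trans (+-cong ≈-refl (≈-sym eq′)) eq)
  ≈±-trans {a} {b} {c} (minus eq) (minus eq′) =
    plus (+-cancelʳ b (≈-trans eq (≈-trans (≈-sym eq′) (≡⇒≈ (+-comm b c)))))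

  ≈±-respˡ-⇔ : ∀ {a b c} → a ≈ b → a ≈± c ⇔ b ≈± c
  ≈±-respˡ-⇔ a≈b = mk⇔ (≈±-trans (plus (≈-sym a≈b))) (≈±-trans (plus a≈b))

  ≈±-*-congˡ : ∀ c {a b} → a ≈± b → c * a ≈± c * b
  ≈±-*-congˡ c (plus eq) = plus (*-cong (≈-refl {c}) eq)
  ≈±-*-congˡ c {a} {b} (minus eq) = minus (≈-trans (≡⇒≈ (sym (*-distribˡ-+ c a b)))
    (≈-trans (*-cong (≈-refl {c}) eq) (≡⇒≈ (*-zeroʳ c))))

  ^-*≈1 : ∀ a c → a ^ c ≈ 1 → ∀ q → a ^ (c * q) ≈ 1
  ^-*≈1 a c a^c≈1 q = ≈-trans (≡⇒≈ (sym (^-*-assoc a c q))) (≈-trans (^-congˡ q a^c≈1) (≡⇒≈ (^-zeroˡ q)))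

  ^-%≈ : ∀ {a} c .{{_ : NonZero c}} → a ^ c ≈ 1 → ∀ e → a ^ (e % c) ≈ a ^ e
  ^-%≈ {a} c a^c≈1 e = ≈-sym (begin
    a ^ e                          ≡⟨ cong (a ^_) (trans (m≡m%n+[m/n]*n e c) (cong (e % c +_) (*-comm (e / c) c))) ⟩
    a ^ (e % c + c * (e / c))      ≡⟨ ^-distribˡ-+-* a (e % c) (c * (e / c)) ⟩
    a ^ (e % c) * a ^ (c * (e / c)) ≈⟨ *-cong (≈-refl {a ^ (e % c)}) (^-*≈1 a c a^c≈1 (e / c)) ⟩
    a ^ (e % c) * 1                ≡⟨ *-identityʳ _ ⟩
    a ^ (e % c)                    ∎)
    where open ≈-Reasoning

module PrimeModulus {p : ℕ} (p-prime : Prime p) where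

  private instance
    p≢0 : NonZero p
    p≢0 = prime⇒nonZero p-prime

  open Congruence p

  p≢1 : p ≢ 1
  p≢1 refl = ¬prime[1] p-prime

  ∤-* : ∀ {a b} → ¬ p ∣ a → ¬ p ∣ b → ¬ p ∣ a * b
  ∤-* p∤a p∤b p∣ab = Sum.[ p∤a , p∤b ] (euclidsLemma _ _ p-prime p∣ab)

  ∤-^ : ∀ {a} n → ¬ p ∣ a → ¬ p ∣ a ^ n
  ∤-^ zero    _   p∣1 = p≢1 (∣1⇒≡1 p∣1)
  ∤-^ (suc n) p∤a = ∤-* p∤a (∤-^ n p∤a)

  ∤-<p : ∀ {a} → 0 < a → a < p → ¬ p ∣ a
  ∤-<p 0<a a<p = >⇒∤ {{>-nonZero 0<a}} a<p

  *-cancelˡ : ∀ c {a b} → ¬ p ∣ c → c * a ≈ c * b → a ≈ b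
  *-cancelˡ c {a} {b} p∤c eq with euclidsLemma c ∣ a - b ∣ p-prime
      (subst (p ∣_) (sym (*-distribˡ-∣-∣ c a b)) (≈⇒∣∣-∣ eq))
  ... | inj₁ p∣c = ⊥-elim (p∤c p∣c)
  ... | inj₂ p∣∣a-b∣ = ∣∣-∣⇒≈ p∣∣a-b∣

  *-cancelʳ : ∀ c {a b} → ¬ p ∣ c → a * c ≈ b * c → a ≈ b
  *-cancelʳ c {a} {b} p∤c eq = *-cancelˡ c p∤c (subst₂ _≈_ (*-comm a c) (*-comm b c) eq)

  ≈±-*-cancelˡ : ∀ c {a b} → ¬ p ∣ c → c * a ≈± c * b → a ≈± b
  ≈±-*-cancelˡ c p∤c (plus eq) = plus (*-cancelˡ c p∤c eq)
  ≈±-*-cancelˡ c {a} {b} p∤c (minus eq) = minus (*-cancelˡ c p∤c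
    (≈-trans (≡⇒≈ (*-distribˡ-+ c a b)) (≈-trans eq (≡⇒≈ (sym (*-zeroʳ c))))))

  -- x² - 1 = (x - 1)(x + 1), written for x = 1 + y so that no subtraction occurs
  square≈1⇒≈±1 : ∀ x → x * x ≈ 1 → x ≈± 1
  square≈1⇒≈±1 zero (mk≈ eq) = ⊥-elim (p≢1 (∣1⇒≡1 (≈0⇒∣ (≈-sym (mk≈ eq)))))
  square≈1⇒≈±1 (suc y) eq with euclidsLemma y (y + 2) p-prime (≈0⇒∣ (+-cancelˡ 1 y[y+2]+1≈1))
    where
    y[y+2]+1≈1 : 1 + y * (y + 2) ≈ 1 + 0
    y[y+2]+1≈1 = ≈-trans (≡⇒≈ (lemma y)) eq
      where lemma : ∀ y → 1 + y * (y + 2) ≡ suc y * suc y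
            lemma = solve-∀
  ... | inj₁ p∣y = plus (+-cong {1} {1} ≈-refl (∣⇒≈0 p∣y))
  ... | inj₂ p∣y+2 = minus (≈-trans (≡⇒≈ (+-comm (suc y) 1)) (∣⇒≈0 (subst (p ∣_) (+-comm y 2) p∣y+2)))

  ≈±1⇒square≈1 : ∀ {x} → x ≈± 1 → x * x ≈ 1
  ≈±1⇒square≈1 (plus eq) = *-cong eq eq
  ≈±1⇒square≈1 {x} (minus eq) = +-cancelʳ x (begin
    x * x + x      ≡⟨ cong (x * x +_) (*-identityʳ x) ⟨
    x * x + x * 1  ≡⟨ *-distribˡ-+ x x 1 ⟨
    x * (x + 1)    ≈⟨ *-cong (≈-refl {x}) eq ⟩
    x * 0          ≡⟨ *-zeroʳ x ⟩
    0              ≈⟨ eq ⟨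
    x + 1          ≡⟨ +-comm x 1 ⟩
    1 + x          ∎)
    where open ≈-Reasoning


∣*⇔/gcd∣ : ∀ N a n .{{_ : NonZero (gcd a N)}} → N ∣ a * n ⇔ N / gcd a N ∣ n
∣*⇔/gcd∣ N a n = mk⇔
  (λ N∣an → coprime-divisor (Coprime.sym (coprime-/gcd a N)) (*-cancelˡ-∣ g (subst₂ _∣_ (sym g*[N/g]≡N) (a*n≡g*[a/g*n]) N∣an)))
  (λ N/g∣n → subst₂ _∣_ g*[N/g]≡N (sym a*n≡g*[a/g*n]) (*-monoʳ-∣ g (∣n⇒∣m*n (a / g) N/g∣n)))
  where
  g : ℕ
  g = gcd a N
  g*[N/g]≡N : g * (N / g) ≡ N
  g*[N/g]≡N = m*[n/m]≡n (gcd[m,n]∣n a N)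
  a*n≡g*[a/g*n] : a * n ≡ g * (a / g * n)
  a*n≡g*[a/g*n] = trans (cong (_* n) (sym (m*[n/m]≡n (gcd[m,n]∣m a N)))) (*-assoc g (a / g) n)

module Generator {N : ℕ} (p-prime : Prime (suc N)) {z : ℕ} (generator : IsGenerator (suc N) z) where

  private
    p : ℕ
    p = suc N

  open Congruence p
  open PrimeModulus p-prime

  instance
    N-nonZero : NonZero N
    N-nonZero = ≢-nonZero (p≢1 ∘ cong suc)

  log : ∀ {s} → 0 < s → s < p → ∃ λ e → z ^ e % p ≡ s
  log = proj₂ (proj₂ generator) _

  p∤z^ : ∀ e → ¬ p ∣ z ^ e
  p∤z^ e = ∤-^ e (∤-<p (proj₁ generator) (proj₁ (proj₂ generator)))

  z^%p>0 : ∀ e → 0 < z ^ e % p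
  z^%p>0 e = n≢0⇒n>0 (p∤z^ e ∘ m%n≡0⇒n∣m (z ^ e) p)

  residue : Fin p → Fin N
  residue e = fromℕ< (≤-trans (≤-reflexive (suc-pred (z ^ toℕ e % p) {{>-nonZero (z^%p>0 (toℕ e))}}))
                              (≤-pred (m%n<n (z ^ toℕ e) p)))

  suc-residue : ∀ e → suc (toℕ (residue e)) ≡ z ^ toℕ e % p
  suc-residue e = trans (cong suc (toℕ-fromℕ< _)) (suc-pred _ {{>-nonZero (z^%p>0 (toℕ e))}})

  -- pigeonhole: the N + 1 powers z⁰, …, z^N take only N nonzero values
  some-power≈1 : ∃ λ c → 0 < c × c ≤ N × z ^ c ≈ 1
  some-power≈1 with i , j , i<j , same ← pigeonhole (n<1+n N) residue =
    toℕ j ∸ toℕ i , m<n⇒0<n∸m i<j , ≤-trans (m∸n≤m (toℕ j) (toℕ i)) (≤-pred (toℕ<n j)) ,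
    ≈-sym (*-cancelˡ (z ^ toℕ i) (p∤z^ (toℕ i)) (begin
      z ^ toℕ i * 1                     ≡⟨ *-identityʳ _ ⟩
      z ^ toℕ i                         ≈⟨ mk≈ equal-residues ⟩
      z ^ toℕ j                         ≡⟨ cong (z ^_) (m+[n∸m]≡n (<⇒≤ i<j)) ⟨
      z ^ (toℕ i + (toℕ j ∸ toℕ i))     ≡⟨ ^-distribˡ-+-* z (toℕ i) _ ⟩
      z ^ toℕ i * z ^ (toℕ j ∸ toℕ i)   ∎))
    where
    open ≈-Reasoning
    equal-residues : z ^ toℕ i % p ≡ z ^ toℕ j % p
    equal-residues = trans (sym (suc-residue i)) (trans (cong (suc ∘ toℕ) same) (suc-residue j))

  exponent : Fin N → ℕ
  exponent k = proj₁ (log {suc (toℕ k)} z<s (s<s (toℕ<n k)))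

  z^exponent : ∀ k → z ^ exponent k % p ≡ suc (toℕ k)
  z^exponent k = proj₂ (log {suc (toℕ k)} z<s (s<s (toℕ<n k)))

  -- pigeonhole again: if c < N, two of the N nonzero residues have logarithms congruent mod c
  power≈1⇒N≤ : ∀ c → 0 < c → z ^ c ≈ 1 → N ≤ c
  power≈1⇒N≤ c@(suc _) _ z^c≈1 with c <? N
  ... | no c≮N = ≮⇒≥ c≮N
  ... | yes c<N with k₁ , k₂ , k₁<k₂ , same ← pigeonhole c<N (λ k → fromℕ< (m%n<n (exponent k) c))
    = ⊥-elim (<⇒≢ k₁<k₂ (suc-injective (begin
      suc (toℕ k₁)              ≡⟨ z^exponent k₁ ⟨
      z ^ exponent k₁ % p       ≡⟨ %-≡ (≈-sym (^-%≈ c z^c≈1 (exponent k₁))) ⟩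
      z ^ (exponent k₁ % c) % p ≡⟨ cong (λ e → z ^ e % p) (trans (sym (toℕ-fromℕ< _)) (trans (cong toℕ same) (toℕ-fromℕ< _))) ⟩
      z ^ (exponent k₂ % c) % p ≡⟨ %-≡ (^-%≈ c z^c≈1 (exponent k₂)) ⟩
      z ^ exponent k₂ % p       ≡⟨ z^exponent k₂ ⟩
      suc (toℕ k₂)              ∎)))
    where open ≡-Reasoning

  z^N≈1 : z ^ N ≈ 1
  z^N≈1 with c , 0<c , c≤N , z^c≈1 ← some-power≈1 =
    subst (λ e → z ^ e ≈ 1) (≤-antisym c≤N (power≈1⇒N≤ c 0<c z^c≈1)) z^c≈1

  z^e≈1⇔N∣e : ∀ e → z ^ e ≈ 1 ⇔ N ∣ e
  z^e≈1⇔N∣e e = mk⇔ z^e≈1⇒N∣e (λ { (divides q refl) → subst (λ k → z ^ k ≈ 1) (*-comm N q) (^-*≈1 z N z^N≈1 q) })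
    where
    z^e≈1⇒N∣e : z ^ e ≈ 1 → N ∣ e
    z^e≈1⇒N∣e z^e≈1 with e % N in eq
    ... | zero = m%n≡0⇒n∣m e N eq
    ... | suc r = ⊥-elim (<⇒≱ (subst (_< N) eq (m%n<n e N))
                    (power≈1⇒N≤ (suc r) z<s (subst (λ k → z ^ k ≈ 1) eq (≈-trans (^-%≈ N z^N≈1 e) z^e≈1))))

  z^e≈±1⇔N∣2e : ∀ e → z ^ e ≈± 1 ⇔ N ∣ 2 * e
  z^e≈±1⇔N∣2e e = mk⇔
    (λ ±1 → Equivalence.to (z^e≈1⇔N∣e (2 * e)) (≈-trans (≡⇒≈ z^2e≡z^e*z^e) (≈±1⇒square≈1 ±1)))
    (λ N∣2e → square≈1⇒≈±1 (z ^ e) (≈-trans (≡⇒≈ (sym z^2e≡z^e*z^e)) (Equivalence.from (z^e≈1⇔N∣e (2 * e)) N∣2e)))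
    where
    z^2e≡z^e*z^e : z ^ (2 * e) ≡ z ^ e * z ^ e
    z^2e≡z^e*z^e = trans (cong (λ k → z ^ (e + k)) (+-identityʳ e)) (^-distribˡ-+-* z e e)

  -- the inverse of w = z^e is z^((N - 1) e)
  inverse : ∀ {w} → 0 < w → w < p → ∃ λ u → w * u ≈ 1
  inverse {w} 0<w w<p with e , z^e≡w ← log 0<w w<p = z ^ ((N ∸ 1) * e) , (begin
    w * z ^ ((N ∸ 1) * e)               ≈⟨ *-cong {w} {z ^ e} (mk≈ (trans (m<n⇒m%n≡m w<p) (sym z^e≡w))) ≈-refl ⟩
    z ^ e * z ^ ((N ∸ 1) * e)           ≡⟨ ^-distribˡ-+-* z e _ ⟨
    z ^ (e + (N ∸ 1) * e)               ≡⟨ cong (z ^_) (cong (_* e) (m+[n∸m]≡n {1} {N} (>-nonZero⁻¹ N))) ⟩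
    z ^ (N * e)                         ≈⟨ ^-*≈1 z N z^N≈1 e ⟩
    1                                   ∎)
    where open ≈-Reasoning

  -- j₀ = (s - 1)⁻¹ (p - t)
  affine-fixed-point : ∀ {s t} → 1 < s → s < p → t < p → ∃ λ j₀ → j₀ < p × s * j₀ + t ≈ j₀
  affine-fixed-point {suc w} {t} (s≤s 0<w) s<p t<p with u , wu≈1 ← inverse 0<w (<-trans (n<1+n w) s<p) =
    j₀ , m%n<n (u * (p ∸ t)) p , (begin
      suc w * j₀ + t               ≡⟨⟩
      j₀ + w * j₀ + t              ≈⟨ +-cong (+-cong (≈-refl {j₀}) w*j₀≈p∸t) (≈-refl {t}) ⟩
      j₀ + (p ∸ t) + t             ≡⟨ trans (+-assoc j₀ (p ∸ t) t) (cong (j₀ +_) (m∸n+n≡m (<⇒≤ t<p))) ⟩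
      j₀ + p                       ≈⟨ +-cong (≈-refl {j₀}) (∣⇒≈0 ∣-refl) ⟩
      j₀ + 0                       ≡⟨ +-identityʳ j₀ ⟩
      j₀                           ∎)
    where
    open ≈-Reasoning
    j₀ : ℕ
    j₀ = (u * (p ∸ t)) % p
    w*j₀≈p∸t : w * j₀ ≈ p ∸ t
    w*j₀≈p∸t = begin
      w * j₀                       ≈⟨ *-cong (≈-refl {w}) (%-≈ (u * (p ∸ t))) ⟩
      w * (u * (p ∸ t))            ≡⟨ *-assoc w u (p ∸ t) ⟨
      w * u * (p ∸ t)              ≈⟨ *-cong wu≈1 (≈-refl {p ∸ t}) ⟩
      1 * (p ∸ t)                  ≡⟨ *-identityˡ (p ∸ t) ⟩
      p ∸ t                        ∎


module Action (m : ℕ) (p-prime : Prime (suc (m + m))) where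

  p : ℕ
  p = suc (m + m)

  open Congruence p
  open PrimeModulus p-prime

  m<p : m < p
  m<p = s≤s (m≤m+n m m)

  [m+m]/2≡m : (m + m) / 2 ≡ m
  [m+m]/2≡m = trans (cong (_/ 2) (trans (cong (m +_) (sym (+-identityʳ m))) (*-comm 2 m))) (m*n/n≡m m 2)

  Bars : List Pt
  Bars = map (λ i → bar (suc i)) (upTo ((m + m) / 2))

  Refs : List Pt
  Refs = map ref (upTo p)

  ∈Bars⁻ : ∀ {x} → x ∈ Bars → ∃ λ r → (0 < r × r ≤ m) × x ≡ bar r
  ∈Bars⁻ x∈ with i , i∈ , refl ← ∈-map⁻ (λ i → bar (suc i)) x∈ = suc i , (z<s , subst (i <_) [m+m]/2≡m (∈-upTo⁻ i∈)) , refl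

  ∈Bars⁺ : ∀ {r} → 0 < r → r ≤ m → bar r ∈ Bars
  ∈Bars⁺ {suc r} _ r<m = ∈-map⁺ (λ i → bar (suc i)) (∈-upTo⁺ (subst (r <_) (sym [m+m]/2≡m) r<m))

  Bars-unique : Unique Bars
  Bars-unique = Unique.map⁺ (λ { refl → refl }) (Unique.upTo⁺ _)

  length-Bars : length Bars ≡ m
  length-Bars = trans (length-map _ (upTo ((m + m) / 2))) (trans (length-upTo _) [m+m]/2≡m)

  Refs-unique : Unique Refs
  Refs-unique = Unique.map⁺ ref-injective (Unique.upTo⁺ p)

  length-Refs : length Refs ≡ p
  length-Refs = trans (length-map ref (upTo p)) (length-upTo p)

  barIndex-range : ∀ v → 0 < v → v < p → 0 < barIndex p v × barIndex p v ≤ m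
  barIndex-range v 0<v v<p rewrite [m+m]/2≡m with v ≤ᵇ m in v≤ᵇm
  ... | true  = 0<v , ≤ᵇ⇒≤ v m (subst T (sym v≤ᵇm) _)
  ... | false = m<n⇒0<n∸m v<p , ≤-trans (∸-monoʳ-≤ {suc m} {v} p m<v) (≤-reflexive (m+n∸m≡n m m))
    where
    m<v : m < v
    m<v = ≰⇒> (λ v≤m → subst T v≤ᵇm (≤⇒≤ᵇ v≤m))

  barIndex-≈± : ∀ v → v < p → barIndex p v ≈± v
  barIndex-≈± v v<p rewrite [m+m]/2≡m with v ≤ᵇ m
  ... | true  = ≈±-refl
  ... | false = minus (≈-trans (≡⇒≈ (m∸n+n≡m (<⇒≤ v<p))) (∣⇒≈0 ∣-refl))

  ≈±-injective : ∀ {a b} → 0 < a × a ≤ m → 0 < b × b ≤ m → a ≈± b → a ≡ b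
  ≈±-injective (_ , a≤m) (_ , b≤m) (plus a≈b) = ≈⇒≡ (≤-<-trans a≤m m<p) (≤-<-trans b≤m m<p) a≈b
  ≈±-injective {a} {b} (0<a , a≤m) (_ , b≤m) (minus a+b≈0) =
    ⊥-elim (∤-<p {a + b} (≤-trans 0<a (m≤m+n a b)) (s≤s (+-mono-≤ a≤m b≤m)) (≈0⇒∣ a+b≈0))

  barIter : ℕ → ℕ → ℕ → ℕ
  barIter s zero    r = r
  barIter s (suc n) r = barIndex p ((s * barIter s n r) % p)

  iter-α-bar : ∀ s t n r → iter (α p s t) n (bar r) ≡ bar (barIter s n r)
  iter-α-bar s t zero    r = refl
  iter-α-bar s t (suc n) r = cong (α p s t) (iter-α-bar s t n r)

  module BarOrbits (s t : ℕ) (p∤s : ¬ p ∣ s) where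

    barIter-range : ∀ n {r} → 0 < r × r ≤ m → 0 < barIter s n r × barIter s n r ≤ m
    barIter-range zero r∈ = r∈
    barIter-range (suc n) {r} r∈ with 0<r′ , r′≤m ← barIter-range n r∈ =
      barIndex-range _ (n≢0⇒n>0 (∤-* p∤s (∤-<p 0<r′ (≤-<-trans r′≤m m<p)) ∘ m%n≡0⇒n∣m (s * barIter s n r) p))
                       (m%n<n (s * barIter s n r) p)

    barIter-≈± : ∀ n {r} → 0 < r × r ≤ m → barIter s n r ≈± s ^ n * r
    barIter-≈± zero {r} _ = plus (≡⇒≈ (sym (*-identityˡ r)))
    barIter-≈± (suc n) {r} r∈ =
      ≈±-trans (barIndex-≈± _ (m%n<n (s * barIter s n r) p))
      (≈±-trans (plus (%-≈ (s * barIter s n r)))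
      (≈±-trans (≈±-*-congˡ s (barIter-≈± n r∈))
                (plus (≡⇒≈ (sym (*-assoc s (s ^ n) r))))))

    bar-period : ∀ {d} → (∀ n → s ^ n ≈± 1 ⇔ d ∣ n) → ∀ {r} → 0 < r × r ≤ m → Period (α p s t) d (bar r)
    bar-period {d} order {r} r∈@(0<r , r≤m) n = mk⇔
      (λ returns → to (order n) (≈±-*-cancelˡ r p∤r (r*s^n≈±r*1 (bar-injective (trans (sym (iter-α-bar s t n r)) returns)))))
      (λ d∣n → trans (iter-α-bar s t n r) (cong bar (≈±-injective (barIter-range n r∈) r∈
        (≈±-trans (barIter-≈± n r∈) (≈±-trans (≡⇒≈± (*-comm (s ^ n) r))
          (≈±-trans (≈±-*-congˡ r (from (order n) d∣n)) (≡⇒≈± (*-identityʳ r))))))))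
      where
      p∤r : ¬ p ∣ r
      p∤r = ∤-<p 0<r (≤-<-trans r≤m m<p)
      r*s^n≈±r*1 : barIter s n r ≡ r → r * s ^ n ≈± r * 1
      r*s^n≈±r*1 r′≡r = ≈±-trans (≡⇒≈± (*-comm r (s ^ n)))
        (≈±-trans (≈±-sym (subst (_≈± s ^ n * r) r′≡r (barIter-≈± n r∈))) (≡⇒≈± (sym (*-identityʳ r))))

    cycles-Bars : ∀ d .{{_ : NonZero d}} → (∀ n → s ^ n ≈± 1 ⇔ d ∣ n) →
                  ∀ {c} → c * d ≡ m → ∀ k → cycles (α p s t) Bars k ≡ [ k ≡ d ]* c
    cycles-Bars d order c*d≡m = cycles-uniform (α p s t) d Bars Bars-unique closed
      (λ x∈ → case ∈Bars⁻ x∈ of λ { (r , r∈ , refl) → bar-period order r∈ })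
      (trans c*d≡m (sym length-Bars))
      where
      closed : ∀ {x} → x ∈ Bars → α p s t x ∈ Bars
      closed x∈ with r , r∈ , refl ← ∈Bars⁻ x∈ = uncurry ∈Bars⁺ (barIter-range 1 r∈)

  refIter : ℕ → ℕ → ℕ → ℕ → ℕ
  refIter s t zero    j = j
  refIter s t (suc n) j = (s * refIter s t n j + t) % p

  iter-α-ref : ∀ s t n j → iter (α p s t) n (ref j) ≡ ref (refIter s t n j)
  iter-α-ref s t zero    j = refl
  iter-α-ref s t (suc n) j = cong (α p s t) (iter-α-ref s t n j)

  refIter<p : ∀ s t n {j} → j < p → refIter s t n j < p
  refIter<p s t zero    j<p = j<p
  refIter<p s t (suc n) {j} _ = m%n<n (s * refIter s t n j + t) p

  ∈Refs⁺ : ∀ {j} → j < p → ref j ∈ Refs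
  ∈Refs⁺ = ∈-map⁺ ref ∘ ∈-upTo⁺

  module AffineOrbits (s t j₀ : ℕ) (j₀<p : j₀ < p) (p∤s : ¬ p ∣ s) (fixed : s * j₀ + t ≈ j₀) where

    refIter-≈ : ∀ n {j e} → j ≈ j₀ + e → refIter s t n j ≈ j₀ + s ^ n * e
    refIter-≈ zero {j} {e} j≈ = ≈-trans j≈ (≡⇒≈ (cong (j₀ +_) (sym (*-identityˡ e))))
    refIter-≈ (suc n) {j} {e} j≈ = begin
      (s * refIter s t n j + t) % p   ≈⟨ %-≈ (s * refIter s t n j + t) ⟩
      s * refIter s t n j + t         ≈⟨ +-cong (*-cong (≈-refl {s}) (refIter-≈ n j≈)) (≈-refl {t}) ⟩
      s * (j₀ + s ^ n * e) + t        ≡⟨ rearrange s j₀ (s ^ n) e t ⟩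
      (s * j₀ + t) + s * s ^ n * e    ≈⟨ +-cong fixed ≈-refl ⟩
      j₀ + s ^ suc n * e              ∎
      where
      open ≈-Reasoning
      rearrange : ∀ s j x e t → s * (j + x * e) + t ≡ (s * j + t) + s * x * e
      rearrange = solve-∀

    -- Δ j ≡ j - j₀ (mod p), without truncated subtraction
    Δ : ℕ → ℕ
    Δ j = j + (p ∸ j₀)

    j≈j₀+Δj : ∀ j → j ≈ j₀ + Δ j
    j≈j₀+Δj j = ≈-sym (begin
      j₀ + (j + (p ∸ j₀))   ≡⟨ x+[y+z]≡y+[x+z] j₀ j _ ⟩
      j + (j₀ + (p ∸ j₀))   ≡⟨ cong (j +_) (m+[n∸m]≡n (<⇒≤ j₀<p)) ⟩
      j + p                 ≈⟨ +-cong (≈-refl {j}) (∣⇒≈0 ∣-refl) ⟩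
      j + 0                 ≡⟨ +-identityʳ j ⟩
      j                     ∎)
      where
      open ≈-Reasoning
      x+[y+z]≡y+[x+z] : ∀ x y z → x + (y + z) ≡ y + (x + z)
      x+[y+z]≡y+[x+z] = solve-∀

    p∤Δ : ∀ {j} → j < p → j ≢ j₀ → ¬ p ∣ Δ j
    p∤Δ {j} j<p j≢j₀ p∣Δ = j≢j₀ (≈⇒≡ j<p j₀<p (begin
      j            ≈⟨ j≈j₀+Δj j ⟩
      j₀ + Δ j     ≈⟨ +-cong (≈-refl {j₀}) (∣⇒≈0 p∣Δ) ⟩
      j₀ + 0       ≡⟨ +-identityʳ j₀ ⟩
      j₀           ∎))
      where open ≈-Reasoning

    ref-period : ∀ {d} → (∀ n → s ^ n ≈ 1 ⇔ d ∣ n) → ∀ {j} → j < p → j ≢ j₀ → Period (α p s t) d (ref j)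
    ref-period order {j} j<p j≢j₀ n = mk⇔
      (λ returns → to (order n) (*-cancelʳ (Δ j) (p∤Δ j<p j≢j₀) (+-cancelˡ j₀ (begin
        j₀ + s ^ n * Δ j       ≈⟨ refIter-≈ n (j≈j₀+Δj j) ⟨
        refIter s t n j        ≡⟨ ref-injective (trans (sym (iter-α-ref s t n j)) returns) ⟩
        j                      ≈⟨ j≈j₀+Δj j ⟩
        j₀ + Δ j               ≡⟨ cong (j₀ +_) (*-identityˡ (Δ j)) ⟨
        j₀ + 1 * Δ j           ∎))))
      (λ d∣n → trans (iter-α-ref s t n j) (cong ref (≈⇒≡ (refIter<p s t n j<p) j<p (begin
        refIter s t n j        ≈⟨ refIter-≈ n (j≈j₀+Δj j) ⟩
        j₀ + s ^ n * Δ j       ≈⟨ +-cong (≈-refl {j₀}) (*-cong (from (order n) d∣n) (≈-refl {Δ j})) ⟩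
        j₀ + 1 * Δ j           ≡⟨ cong (j₀ +_) (*-identityˡ (Δ j)) ⟩
        j₀ + Δ j               ≈⟨ j≈j₀+Δj j ⟨
        j                      ∎))))
      where open ≈-Reasoning

    Others : List ℕ
    Others = filter (¬? ∘ (_≟ j₀)) (upTo p)

    ∈Others⁻ : ∀ {j} → j ∈ Others → j < p × j ≢ j₀
    ∈Others⁻ j∈ with j∈upTo , j≢j₀ ← ∈-filter⁻ (¬? ∘ (_≟ j₀)) {xs = upTo p} j∈ = ∈-upTo⁻ j∈upTo , j≢j₀

    ∈Others⁺ : ∀ {j} → j < p → j ≢ j₀ → j ∈ Others
    ∈Others⁺ j<p = ∈-filter⁺ (¬? ∘ (_≟ j₀)) (∈-upTo⁺ j<p)

    upTo↭j₀∷Others : upTo p ↭ j₀ ∷ Others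
    upTo↭j₀∷Others = ↭-∷-filter≢ (Unique.upTo⁺ p) (∈-upTo⁺ j₀<p)

    α-ref-j₀ : α p s t (ref j₀) ≡ ref j₀
    α-ref-j₀ = cong ref (≈⇒≡ (m%n<n (s * j₀ + t) p) j₀<p (≈-trans (%-≈ (s * j₀ + t)) fixed))

    α-ref-≢j₀ : ∀ {j} → j < p → j ≢ j₀ → refIter s t 1 j ≢ j₀
    α-ref-≢j₀ {j} j<p j≢j₀ hits = ∤-* (∤-^ 1 p∤s) (p∤Δ j<p j≢j₀) (≈0⇒∣ (+-cancelˡ j₀ (begin
      j₀ + s ^ 1 * Δ j       ≈⟨ refIter-≈ 1 (j≈j₀+Δj j) ⟨
      refIter s t 1 j        ≡⟨ hits ⟩
      j₀                     ≡⟨ +-identityʳ j₀ ⟨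
      j₀ + 0                 ∎)))
      where open ≈-Reasoning

    cycles-Refs : ∀ d .{{_ : NonZero d}} → (∀ n → s ^ n ≈ 1 ⇔ d ∣ n) →
                  ∀ {c} → c * d ≡ m + m → ∀ k → cycles (α p s t) Refs k ≡ [ k ≡ 1 ]* 1 + [ k ≡ d ]* c
    cycles-Refs d order {c} c*d≡2m k = begin
      cycles f Refs k                                          ≡⟨ cycles-↭ f (map⁺ ref upTo↭j₀∷Others) k ⟩
      cycles f ((ref j₀ ∷ []) ++ map ref Others) k             ≡⟨ cycles-++ f (ref j₀ ∷ []) (map ref Others) k ⟩
      cycles f (ref j₀ ∷ []) k + cycles f (map ref Others) k   ≡⟨ cong₂ _+_ (cycles-fixed f α-ref-j₀ k) cycles-Others ⟩
      [ k ≡ 1 ]* 1 + [ k ≡ d ]* c                              ∎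
      where
      open ≡-Reasoning
      f : Pt → Pt
      f = α p s t
      closed : ∀ {x} → x ∈ map ref Others → f x ∈ map ref Others
      closed x∈ with j , j∈ , refl ← ∈-map⁻ ref x∈ with j<p , j≢j₀ ← ∈Others⁻ j∈ =
        ∈-map⁺ ref (∈Others⁺ (refIter<p s t 1 j<p) (α-ref-≢j₀ j<p j≢j₀))
      period : ∀ {x} → x ∈ map ref Others → Period f d x
      period x∈ with j , j∈ , refl ← ∈-map⁻ ref x∈ = uncurry (ref-period order) (∈Others⁻ j∈)
      length-Others : length (map ref Others) ≡ m + m
      length-Others = trans (length-map ref Others) (suc-injective (trans (sym (↭-length upTo↭j₀∷Others)) (length-upTo p)))
      cycles-Others : cycles f (map ref Others) k ≡ [ k ≡ d ]* c
      cycles-Others = cycles-uniform f d (map ref Others)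
        (Unique.map⁺ ref-injective (Unique.filter⁺ (¬? ∘ (_≟ j₀)) (Unique.upTo⁺ p)))
        closed period (trans c*d≡2m (sym length-Others)) k

  p∤1 : ¬ p ∣ 1
  p∤1 = p≢1 ∘ ∣1⇒≡1

  cycles-Bars-1 : ∀ t k → cycles (α p 1 t) Bars k ≡ [ k ≡ 1 ]* m
  cycles-Bars-1 t = BarOrbits.cycles-Bars 1 t p∤1 1
    (λ n → mk⇔ (λ _ → 1∣ n) (λ _ → ≡⇒≈± (^-zeroˡ n))) (*-identityʳ m)

  cycles-identity : ∀ k → b p 1 0 k ≡ [ k ≡ 1 ]* (m + p)
  cycles-identity k = begin
    b p 1 0 k                                              ≡⟨ cycles-++ (α p 1 0) Bars Refs k ⟩
    cycles (α p 1 0) Bars k + cycles (α p 1 0) Refs k      ≡⟨ cong₂ _+_ (cycles-Bars-1 0 k) cycles-Refs ⟩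
    [ k ≡ 1 ]* m + [ k ≡ 1 ]* p                            ≡⟨ [≡]*-+ k 1 m p ⟩
    [ k ≡ 1 ]* (m + p)                                     ∎
    where
    open ≡-Reasoning
    fixes : ∀ {x} → x ∈ Refs → α p 1 0 x ≡ x
    fixes x∈ with j , j∈ , refl ← ∈-map⁻ ref x∈ =
      cong ref (trans (cong (_% p) (trans (+-identityʳ (1 * j)) (*-identityˡ j))) (m<n⇒m%n≡m (∈-upTo⁻ j∈)))
    cycles-Refs : cycles (α p 1 0) Refs k ≡ [ k ≡ 1 ]* p
    cycles-Refs = cycles-uniform (α p 1 0) 1 Refs Refs-unique
      (λ x∈ → subst (_∈ Refs) (sym (fixes x∈)) x∈) (λ x∈ → fixed⇒period-1 (α p 1 0) (fixes x∈))
      (trans (*-identityʳ p) (sym length-Refs)) k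

  module Translation (t : ℕ) (0<t : 0 < t) (t<p : t < p) where

    refIter-≈ : ∀ n j → refIter 1 t n j ≈ j + n * t
    refIter-≈ zero    j = ≡⇒≈ (sym (+-identityʳ j))
    refIter-≈ (suc n) j = begin
      (1 * refIter 1 t n j + t) % p   ≈⟨ %-≈ (1 * refIter 1 t n j + t) ⟩
      1 * refIter 1 t n j + t         ≈⟨ +-cong (*-cong (≈-refl {1}) (refIter-≈ n j)) (≈-refl {t}) ⟩
      1 * (j + n * t) + t             ≡⟨ rearrange j (n * t) t ⟩
      j + suc n * t                   ∎
      where
      open ≈-Reasoning
      rearrange : ∀ j x t → 1 * (j + x) + t ≡ j + (t + x)
      rearrange = solve-∀

    ref-period : ∀ {j} → j < p → Period (α p 1 t) p (ref j)
    ref-period {j} j<p n = mk⇔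
      (λ returns → p∣n (≈0⇒∣ (+-cancelˡ j (begin
        j + n * t          ≈⟨ refIter-≈ n j ⟨
        refIter 1 t n j    ≡⟨ ref-injective (trans (sym (iter-α-ref 1 t n j)) returns) ⟩
        j                  ≡⟨ +-identityʳ j ⟨
        j + 0              ∎))))
      (λ p∣n → trans (iter-α-ref 1 t n j) (cong ref (≈⇒≡ (refIter<p 1 t n j<p) j<p (begin
        refIter 1 t n j    ≈⟨ refIter-≈ n j ⟩
        j + n * t          ≈⟨ +-cong (≈-refl {j}) (∣⇒≈0 (∣m⇒∣m*n t p∣n)) ⟩
        j + 0              ≡⟨ +-identityʳ j ⟩
        j                  ∎))))
      where
      open ≈-Reasoning
      p∣n : p ∣ n * t → p ∣ n
      p∣n p∣nt with euclidsLemma n t p-prime p∣nt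
      ... | inj₁ p∣n = p∣n
      ... | inj₂ p∣t = ⊥-elim (∤-<p 0<t t<p p∣t)

    cycles-translation : ∀ k → b p 1 t k ≡ [ k ≡ 1 ]* m + [ k ≡ p ]* 1
    cycles-translation k = trans (cycles-++ (α p 1 t) Bars Refs k) (cong₂ _+_ (cycles-Bars-1 t k) cycles-Refs)
      where
      closed : ∀ {x} → x ∈ Refs → α p 1 t x ∈ Refs
      closed x∈ with j , j∈ , refl ← ∈-map⁻ ref x∈ = ∈Refs⁺ (refIter<p 1 t 1 (∈-upTo⁻ j∈))
      cycles-Refs : cycles (α p 1 t) Refs k ≡ [ k ≡ p ]* 1
      cycles-Refs = cycles-uniform (α p 1 t) p Refs Refs-unique closed
        (λ x∈ → case ∈-map⁻ ref x∈ of λ { (j , j∈ , refl) → ref-period (∈-upTo⁻ j∈) })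
        (trans (*-identityˡ p) (sym length-Refs)) k


module PowerOfGenerator (m : ℕ) (p-prime : Prime (suc (m + m))) {z : ℕ} (generator : IsGenerator (suc (m + m)) z)
  (i : ℕ) (i<2m : i < m + m) (i≢0 : i ≢ 0) where

  open Action m p-prime
  open Congruence p
  open PrimeModulus p-prime
  open Generator p-prime generator

  s : ℕ
  s = z ^ i % p

  s^n≈z^[i*n] : ∀ n → s ^ n ≈ z ^ (i * n)
  s^n≈z^[i*n] n = ≈-trans (^-congˡ n (%-≈ (z ^ i))) (≡⇒≈ (^-*-assoc z i n))

  p∤s : ¬ p ∣ s
  p∤s = p∤z^ i ∘ ≈0⇒∣ ∘ ≈-trans (≈-sym (%-≈ (z ^ i))) ∘ ∣⇒≈0

  1<s : 1 < s
  1<s with s in s≡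
  ... | 0 = ⊥-elim (p∤s (subst (p ∣_) (sym s≡) (p ∣0)))
  ... | 1 = ⊥-elim (>⇒∤ {{≢-nonZero i≢0}} i<2m (Equivalence.to (z^e≈1⇔N∣e i) (mk≈ (trans s≡ (sym (m<n⇒m%n≡m {n = p} (s≤s (≤-<-trans z≤n i<2m))))))))
  ... | suc (suc _) = s≤s (s≤s z≤n)

  g₁ g₂ : ℕ
  g₁ = gcd i (m + m)
  g₂ = gcd (2 * i) (m + m)

  gcd-nonZero : ∀ a → NonZero (gcd a (m + m))
  gcd-nonZero a = ≢-nonZero (gcd[m,n]≢0 a (m + m) (inj₂ (≢-nonZero⁻¹ (m + m))))

  instance
    g₁-nonZero : NonZero g₁
    g₁-nonZero = gcd-nonZero i
    g₂-nonZero : NonZero g₂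
    g₂-nonZero = gcd-nonZero (2 * i)

  d₁ d₂ : ℕ
  d₁ = (m + m) / g₁
  d₂ = (m + m) / g₂

  instance
    d₁-nonZero : NonZero d₁
    d₁-nonZero = >-nonZero (m≥n⇒m/n>0 (∣⇒≤ (gcd[m,n]∣n i (m + m))))
    d₂-nonZero : NonZero d₂
    d₂-nonZero = >-nonZero (m≥n⇒m/n>0 (∣⇒≤ (gcd[m,n]∣n (2 * i) (m + m))))

  g₁*d₁≡m+m : g₁ * d₁ ≡ m + m
  g₁*d₁≡m+m = m*[n/m]≡n (gcd[m,n]∣n i (m + m))

  g₂*d₂≡m+m : g₂ * d₂ ≡ m + m
  g₂*d₂≡m+m = m*[n/m]≡n (gcd[m,n]∣n (2 * i) (m + m))

  order : ∀ n → s ^ n ≈ 1 ⇔ d₁ ∣ n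
  order n = ⇔.trans (≈-respˡ-⇔ (s^n≈z^[i*n] n)) (⇔.trans (z^e≈1⇔N∣e (i * n)) (∣*⇔/gcd∣ (m + m) i n))

  order± : ∀ n → s ^ n ≈± 1 ⇔ d₂ ∣ n
  order± n = ⇔.trans (≈±-respˡ-⇔ (s^n≈z^[i*n] n))
    (⇔.trans (z^e≈±1⇔N∣2e (i * n))
    (⇔.trans (mk⇔ (subst (m + m ∣_) (sym (*-assoc 2 i n))) (subst (m + m ∣_) (*-assoc 2 i n)))
             (∣*⇔/gcd∣ (m + m) (2 * i) n)))

  2∣g₂ : 2 ∣ g₂
  2∣g₂ = gcd-greatest (m∣m*n i) (subst (2 ∣_) (cong (m +_) (+-identityʳ m)) (m∣m*n m))

  c₂ : ℕ
  c₂ = g₂ / 2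

  c₂*d₂≡m : c₂ * d₂ ≡ m
  c₂*d₂≡m = *-cancelˡ-≡ (c₂ * d₂) m 2 (begin
    2 * (c₂ * d₂)     ≡⟨ *-assoc 2 c₂ d₂ ⟨
    2 * c₂ * d₂       ≡⟨ cong (_* d₂) (m*[n/m]≡n 2∣g₂) ⟩
    g₂ * d₂           ≡⟨ g₂*d₂≡m+m ⟩
    m + m             ≡⟨ cong (m +_) (+-identityʳ m) ⟨
    2 * m             ∎)
    where open ≡-Reasoning

  cycles-power : ∀ t → t < p → ∀ k → b p s t k ≡ [ k ≡ 1 ]* 1 + [ k ≡ d₂ ]* c₂ + [ k ≡ d₁ ]* g₁
  cycles-power t t<p k with j₀ , j₀<p , fixed ← affine-fixed-point 1<s (m%n<n (z ^ i) p) t<p = begin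
    b p s t k                                                ≡⟨ cycles-++ (α p s t) Bars Refs k ⟩
    cycles (α p s t) Bars k + cycles (α p s t) Refs k        ≡⟨ cong₂ _+_
      (BarOrbits.cycles-Bars s t p∤s d₂ order± c₂*d₂≡m k)
      (AffineOrbits.cycles-Refs s t j₀ j₀<p p∤s fixed d₁ order g₁*d₁≡m+m k) ⟩
    [ k ≡ d₂ ]* c₂ + ([ k ≡ 1 ]* 1 + [ k ≡ d₁ ]* g₁)         ≡⟨ rearrange ([ k ≡ d₂ ]* c₂) ([ k ≡ 1 ]* 1) ([ k ≡ d₁ ]* g₁) ⟩
    [ k ≡ 1 ]* 1 + [ k ≡ d₂ ]* c₂ + [ k ≡ d₁ ]* g₁           ∎
    where
    open ≡-Reasoning
    rearrange : ∀ a b c → a + (b + c) ≡ b + a + c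
    rearrange = solve-∀

odd⇒≡1+2m : ∀ n → ¬ 2 ∣ n → ∃ λ m → n ≡ suc (m + m)
odd⇒≡1+2m n 2∤n with n % 2 in n%2≡ | m%n<n n 2
... | 0           | _ = ⊥-elim (2∤n (m%n≡0⇒n∣m n 2 n%2≡))
... | 1           | _ = n / 2 , (begin
  n                     ≡⟨ m≡m%n+[m/n]*n n 2 ⟩
  n % 2 + n / 2 * 2     ≡⟨ cong (_+ n / 2 * 2) n%2≡ ⟩
  1 + n / 2 * 2         ≡⟨ cong suc (*-comm (n / 2) 2) ⟩
  1 + 2 * (n / 2)       ≡⟨ cong (λ x → suc (n / 2 + x)) (+-identityʳ (n / 2)) ⟩
  suc (n / 2 + n / 2)   ∎)
  where open ≡-Reasoning
... | suc (suc _) | s≤s (s≤s ())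

div≡/ : ∀ x y .{{_ : NonZero y}} → x div y ≡ x / y
div≡/ x (suc y) = refl

[3[1+2m]∸1]/2≡m+[1+2m] : ∀ m → (3 * suc (m + m) ∸ 1) / 2 ≡ m + suc (m + m)
[3[1+2m]∸1]/2≡m+[1+2m] m = trans (cong (λ x → (x ∸ 1) / 2) (3[1+2m]≡1+[m+[1+2m]]*2 m)) (m*n/n≡m (m + suc (m + m)) 2)
  where
  3[1+2m]≡1+[m+[1+2m]]*2 : ∀ m → 3 * suc (m + m) ≡ suc ((m + suc (m + m)) * 2)
  3[1+2m]≡1+[m+[1+2m]]*2 = solve-∀

lemma4p1 : (p : ℕ) → Prime p → ¬ (2 ∣ p) →
    -- the case s = 1
    ((t k : ℕ) → t < p → 1 ≤ k → k ≤ (3 * p ∸ 1) / 2 →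
      (t ≡ 0 → b p 1 t k ≡ [ k ≡ 1 ]* ((3 * p ∸ 1) / 2)) ×
      (t ≢ 0 → b p 1 t k ≡ [ k ≡ 1 ]* ((p ∸ 1) / 2) + [ k ≡ p ]* 1))
    ×
    -- the case s = z^i ≠ 1
    ((z : ℕ) → IsGenerator p z → (i t k : ℕ) → i < p ∸ 1 → i ≢ 0 →
      t < p → 1 ≤ k → k ≤ (3 * p ∸ 1) / 2 →
      let s = (z Data.Nat.^ i) mod p in
      b p s t k ≡ b p s 0 k ×
      b p s 0 k ≡ [ k ≡ 1 ]* 1
                  + [ k ≡ (p ∸ 1) div gcd (2 * i) (p ∸ 1) ]* (gcd (2 * i) (p ∸ 1) / 2)
                  + [ k ≡ (p ∸ 1) div gcd i (p ∸ 1) ]* gcd i (p ∸ 1))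
lemma4p1 p p-prime 2∤p with m , refl ← odd⇒≡1+2m p 2∤p =
  (λ t k t<p _ _ →
    (λ { refl → trans (cycles-identity k) (cong ([ k ≡ 1 ]*_) (sym ([3[1+2m]∸1]/2≡m+[1+2m] m))) }) ,
    (λ t≢0 → trans (Translation.cycles-translation t (n≢0⇒n>0 t≢0) t<p k)
                   (cong (λ h → [ k ≡ 1 ]* h + [ k ≡ p ]* 1) (sym [m+m]/2≡m)))) ,
  (λ z generator i t k i<2m i≢0 t<p _ _ →
    let open PowerOfGenerator m p-prime generator i i<2m i≢0 in
    trans (cycles-power t t<p k) (sym (cycles-power 0 z<s k)) ,
    trans (cycles-power 0 z<s k) (cong₂ (λ x y → [ k ≡ 1 ]* 1 + [ k ≡ x ]* c₂ + [ k ≡ y ]* g₁)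
      (sym (div≡/ (m + m) g₂)) (sym (div≡/ (m + m) g₁))))
  where open Action m p-prime hiding (p)
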